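{- The monad $\widetilde{PQ}$ is not commutative. Specifically, let $X=\{x_1,x_2\}$, $Y=\{y_1,y_2\}$, $U=\{\{x_1\},\{x_2\},\{x_1,x_2\}\}\in\widetilde{PQ}(X)$ and $V=\{\{y_1,y_2\}\}\in\widetilde{PQ}(Y)$. Then \[\mu_{X\times Y}\big(\widetilde{PQ}(\mathsf{str}_{X,Y})(\mathsf{stl}_{\widetilde{PQ}X,Y}(U,V))\big)\neq\mu_{X\times Y}\big(\widetilde{PQ}(\mathsf{stl}_{X,Y})(\mathsf{str}_{X,\widetilde{PQ}Y}(U,V))\big).\]
   Context: $Q$ is the non-empty finite powerset monad on Set. For $\mathcal U\subseteq Q(X)$, $\mathsf{cl}(\mathcal U)=\{\bigcup\mathcal V\mid\mathcal V\text{ a finite non-empty subset of }\mathcal U\}$, and $\widetilde{PQ}(X)=\{\mathcal U\subseteq Q(X)\mid\mathsf{cl}(\mathcal U)=\mathcal U\}$ (sets of finite non-empty subsets closed under binary union). $\widetilde{PQ}$ is a monad with unit $x\mapsto\{\{x\}\}$, functor action $\widetilde{PQ}(h)(\mathcal U)=\{h[W]\mid W\in\mathcal U\}$, and multiplication $\mu_Z(\mathfrak U)=\{\bigcup_{\mathcal W\in u}\bigcup\mathcal V_{\mathcal W}\mid u\in\mathfrak U,\ \mathcal V_{\mathcal W}\text{ a finite non-empty subset of }\mathcal W\text{ for each }\mathcal W\in u\}$ for $\mathfrak U\in\widetilde{PQ}(\widetilde{PQ}(Z))$ (this is the composite monad from the weak distributive law $\delta(\{U_i\}_i)=\{\bigcup_iV_i\mid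 V_i\text{ finite non-empty}\subseteq U_i\}$). Strengths: $\mathsf{stl}_{Z,W}(z,\mathcal U)=\widetilde{PQ}(w\mapsto(z,w))(\mathcal U)$ and $\mathsf{str}_{Z,W}(\mathcal U,w)=\widetilde{PQ}(z\mapsto(z,w))(\mathcal U)$. A monad is commutative when $\mu\circ T(\mathsf{str})\circ\mathsf{stl}=\mu\circ T(\mathsf{stl})\circ\mathsf{str}$ as maps $T(X)\times T(Y)\to T(X\times Y)$ for all sets $X,Y$. -}

module Defs where

open import Level using (Level; _⊔_; 0ℓ) renaming (suc to lsuc)
open import Data.Product using (Σ; _×_; _,_; proj₁; proj₂)
open import Data.Sum using (_⊎_)
open import Data.List using (List; []; _∷_; _++_; concatMap)
open import Data.List.NonEmpty using (List⁺; toList; _⁺++⁺_) renaming (map to map⁺; [_] to [_]⁺)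
open import Data.List.Relation.Unary.All using (All; []; _∷_)
open import Data.List.Relation.Unary.Any using (Any)
open import Relation.Binary.PropositionalEquality using (_≡_)
open import Relation.Nullary using (¬_)

private
  variable
    a b c ℓ ℓ' p q : Level

-- Every type carrying sets is equipped with an "equality of elements"
-- relation (propositional ≡ for the base sets X, Y; extensional
-- equality for sets of sets).  A finite non-empty subset of A (an
-- element of Q(A)) is represented by a non-empty list, two such lists
-- denoting the same set iff they have the same elements.

Rel : Set a → (ℓ : Level) → Set (a ⊔ lsuc ℓ)
Rel A ℓ = A → A → Set ℓ

_∈⟨_⟩_ : {A : Set a} → A → Rel A ℓ → List A → Set (a ⊔ ℓ)
x ∈⟨ _≈_ ⟩ xs = Any (x ≈_) xs

SameSet : {A : Set a} → Rel A ℓ → List A → List A → Set (a ⊔ ℓ)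
SameSet _≈_ xs ys =
  All (λ x → x ∈⟨ _≈_ ⟩ ys) xs × All (λ y → y ∈⟨ _≈_ ⟩ xs) ys

Q : Set a → Set a
Q = List⁺

_≋Q⟨_⟩_ : {A : Set a} → Q A → Rel A ℓ → Q A → Set (a ⊔ ℓ)
W ≋Q⟨ _≈_ ⟩ W' = SameSet _≈_ (toList W) (toList W')

-- (raw) elements of PQ~(A): subsets of Q(A), given as predicates

PQ : Set a → (p : Level) → Set (a ⊔ lsuc p)
PQ A p = Q A → Set p

_≐_ : {A : Set a} → PQ A p → PQ A q → Set (a ⊔ p ⊔ q)
𝒰 ≐ 𝒱 = ∀ W → (𝒰 W → 𝒱 W) × (𝒱 W → 𝒰 W)

-- equality of elements of PQ(A), used as the element equality of PQ(PQ(A))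
_≐ₚ_ : {A : Set a} → Rel (PQ A p) (a ⊔ p)
_≐ₚ_ = _≐_

-- cl(𝒰) = 𝒰, i.e. closure under binary union (modulo set equality)
IsClosed : {A : Set a} → PQ A p → Set (a ⊔ p)
IsClosed 𝒰 = ∀ W W' → 𝒰 W → 𝒰 W' → 𝒰 (W ⁺++⁺ W')

fromList : {A : Set a} → Rel A ℓ → List (Q A) → PQ A (a ⊔ ℓ)
fromList _≈_ Ws W = Any (λ W₀ → W ≋Q⟨ _≈_ ⟩ W₀) Ws

_×ᴿ_ : {A : Set a} {B : Set b} → Rel A ℓ → Rel B ℓ' → Rel (A × B) (ℓ ⊔ ℓ')
(R ×ᴿ S) (x , y) (x' , y') = R x x' × S y y'

PQmap : {A : Set a} {B : Set b} → Rel B ℓ → (A → B) → PQ A p → PQ B (a ⊔ b ⊔ ℓ ⊔ p)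
PQmap {A = A} _≈_ h 𝒰 W' = Σ (Q A) λ W → 𝒰 W × (W' ≋Q⟨ _≈_ ⟩ map⁺ h W)

stl : {Z : Set a} {W : Set b} → Rel (Z × W) ℓ → Z × PQ W p → PQ (Z × W) (a ⊔ b ⊔ ℓ ⊔ p)
stl R (z , 𝒰) = PQmap R (λ w → (z , w)) 𝒰

str : {Z : Set a} {W : Set b} → Rel (Z × W) ℓ → PQ Z p × W → PQ (Z × W) (a ⊔ b ⊔ ℓ ⊔ p)
str R (𝒰 , w) = PQmap R (λ z → (z , w)) 𝒰

-- Multiplication
-- μ(𝔘) = { ⋃_{𝒲∈u} ⋃ 𝒱_𝒲 | u ∈ 𝔘, 𝒱_𝒲 finite non-empty ⊆ 𝒲 for each 𝒲 ∈ u }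

Choice : {Z : Set a} → List (PQ Z p) → Set (a ⊔ lsuc p)
Choice {Z = Z} ws = All (λ 𝒲 → Σ (List⁺ (Q Z)) λ 𝒱 → All 𝒲 (toList 𝒱)) ws

unionOf : {Z : Set a} {ws : List (PQ Z p)} → Choice ws → List Z
unionOf [] = []
unionOf ((𝒱 , _) ∷ cs) = concatMap toList (toList 𝒱) ++ unionOf cs

μ : {a ℓ p q : Level} {Z : Set a} → Rel Z ℓ → PQ (PQ Z p) q → PQ Z (a ⊔ lsuc p ⊔ q ⊔ ℓ)
μ {p = p} {Z = Z} _≈_ 𝔘 S =
  Σ (Q (PQ Z p)) λ u → 𝔘 u × Σ (Choice (toList u)) λ ch → SameSet _≈_ (toList S) (unionOf ch)

data X : Set where
  x₁ x₂ : X

data Y : Set where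
  y₁ y₂ : Y

U : PQ X 0ℓ
U = fromList _≡_ ([ x₁ ]⁺ ∷ [ x₂ ]⁺ ∷ (x₁ List⁺.∷ (x₂ ∷ [])) ∷ [])
  where import Data.List.NonEmpty as List⁺

V : PQ Y 0ℓ
V = fromList _≡_ ((y₁ List⁺.∷ (y₂ ∷ [])) ∷ [])
  where import Data.List.NonEmpty as List⁺

_≈XY_ : Rel (X × Y) 0ℓ
_≈XY_ = _≡_ ×ᴿ _≡_

lhs : PQ (X × Y) _
lhs = μ _≈XY_ (PQmap _≐ₚ_ (str _≈XY_) (stl (_≐ₚ_ ×ᴿ _≡_) (U , V)))

rhs : PQ (X × Y) _
rhs = μ _≈XY_ (PQmap _≐ₚ_ (stl _≈XY_) (str (_≡_ ×ᴿ _≐ₚ_) (U , V)))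

-- Call a list of pairs saturated when, with (x , y), it contains (x , y') for every y'.
-- μ only forms unions of chosen members, and unions preserve saturation; on the right every
-- member of every family is a set { (x , y) | y ∈ W } with W ∈ V = {Y}, hence saturated, so every
-- member of the right-hand side is saturated.  On the left, str(U, y₁) and str(U, y₂) are
-- separate families, and choosing {(x₁ , y₁)} from the first and {(x₂ , y₂)} from the second
-- yields the unsaturated set {(x₁ , y₁) , (x₂ , y₂)}.
module Submission where

open import Defs
open import Data.Product using (_×_)
open import Relation.Nullary using (¬_)

open import Level using (Level; 0ℓ; _⊔_)
open import Data.Product using (_,_; proj₁; proj₂)
open import Data.Sum using (inj₁; inj₂)
open import Data.List using (List; []; _∷_; _++_; map; concatMap)
open import Data.List.NonEmpty using (toList; _⁺++⁺_) renaming (_∷_ to _∷⁺_; [_] to [_]⁺)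
open import Data.List.Relation.Unary.All as All using (All; []; _∷_; all?)
import Data.List.Relation.Unary.All.Properties as All
open import Data.List.Relation.Unary.Any as Any using (Any; here; there; any?)
import Data.List.Relation.Unary.Any.Properties as Any
open import Relation.Binary.Definitions using (Reflexive; Transitive; Decidable; DecidableEquality)
open import Relation.Binary.PropositionalEquality using (_≡_; _≢_; refl; sym; trans)
open import Relation.Nullary using (Dec; yes; no)
open import Relation.Nullary.Decidable using (toWitness; _×-dec_)

private
  variable
    a ℓ p q r : Level

UnionsListed : {A : Set a} → Rel A ℓ → List (Q A) → Set (a ⊔ ℓ)
UnionsListed _≈_ Ws = All (λ W → All (λ W′ → fromList _≈_ Ws (W ⁺++⁺ W′)) Ws) Ws

module _ {A : Set a} {_≈_ : Rel A ℓ} where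

  ∈-resp-⊆ : Transitive _≈_ → ∀ {x xs ys} →
             x ∈⟨ _≈_ ⟩ xs → All (λ y → y ∈⟨ _≈_ ⟩ ys) xs → x ∈⟨ _≈_ ⟩ ys
  ∈-resp-⊆ ≈-trans (here x≈y)   (y∈ys ∷ _)  = Any.map (≈-trans x≈y) y∈ys
  ∈-resp-⊆ ≈-trans (there x∈xs) (_ ∷ xs⊆ys) = ∈-resp-⊆ ≈-trans x∈xs xs⊆ys

  SameSet-refl : Reflexive _≈_ → ∀ xs → SameSet _≈_ xs xs
  SameSet-refl ≈-refl xs = xs⊆xs , xs⊆xs
    where
    xs⊆xs : All (λ x → x ∈⟨ _≈_ ⟩ xs) xs
    xs⊆xs = All.tabulate (Any.map λ { refl → ≈-refl })

  SameSet-trans : Transitive _≈_ → ∀ {xs ys zs} →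
                  SameSet _≈_ xs ys → SameSet _≈_ ys zs → SameSet _≈_ xs zs
  SameSet-trans ≈-trans (xs⊆ys , ys⊆xs) (ys⊆zs , zs⊆ys) =
    All.map (λ x∈ys → ∈-resp-⊆ ≈-trans x∈ys ys⊆zs) xs⊆ys ,
    All.map (λ z∈ys → ∈-resp-⊆ ≈-trans z∈ys ys⊆xs) zs⊆ys

  SameSet-++ : ∀ {xs xs′ ys ys′} → SameSet _≈_ xs xs′ → SameSet _≈_ ys ys′ →
               SameSet _≈_ (xs ++ ys) (xs′ ++ ys′)
  SameSet-++ {xs} {xs′} (xs⊆xs′ , xs′⊆xs) (ys⊆ys′ , ys′⊆ys) =
    All.++⁺ (All.map Any.++⁺ˡ xs⊆xs′) (All.map (Any.++⁺ʳ xs′) ys⊆ys′) ,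
    All.++⁺ (All.map Any.++⁺ˡ xs′⊆xs) (All.map (Any.++⁺ʳ xs) ys′⊆ys)

  fromList-closed : Transitive _≈_ → ∀ Ws → UnionsListed _≈_ Ws → IsClosed (fromList _≈_ Ws)
  fromList-closed ≈-trans Ws listed W W′ W∈Ws W′∈Ws
    with W₀-listed , W≋W₀ ← All.lookupAny listed W∈Ws
    with W₀W₁∈Ws , W′≋W₁ ← All.lookupAny W₀-listed W′∈Ws =
    Any.map (SameSet-trans ≈-trans (SameSet-++ W≋W₀ W′≋W₁)) W₀W₁∈Ws

  unionsListed? : Decidable _≈_ → ∀ Ws → Dec (UnionsListed _≈_ Ws)
  unionsListed? _≈?_ Ws =
    all? (λ W → all? (λ W′ → any? (λ W₀ → sameSet? (toList (W ⁺++⁺ W′)) (toList W₀)) Ws) Ws) Ws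
    where
    sameSet? : ∀ xs ys → Dec (SameSet _≈_ xs ys)
    sameSet? xs ys = all? (λ x → any? (x ≈?_) ys) xs ×-dec all? (λ y → any? (y ≈?_) xs) ys

module _ {Z : Set a} where

  Members : (List Z → Set p) → PQ Z q → Set (a ⊔ p ⊔ q)
  Members P 𝒲 = ∀ W → 𝒲 W → P (toList W)

  Members-resp-≐ : {P : List Z → Set p} {𝒲 : PQ Z q} {𝒲′ : PQ Z r} →
                   𝒲 ≐ 𝒲′ → Members P 𝒲′ → Members P 𝒲
  Members-resp-≐ 𝒲≐𝒲′ good W W∈𝒲 = good W (proj₁ (𝒲≐𝒲′ W) W∈𝒲)

  module _ {_≈_ : Rel Z ℓ} (P : List Z → Set p) (P-[] : P [])
           (P-++ : ∀ {xs ys} → P xs → P ys → P (xs ++ ys))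
           (P-resp : ∀ {xs ys} → SameSet _≈_ xs ys → P ys → P xs) where

    μ-preserves : {𝔘 : PQ (PQ Z q) r} →
                  (∀ u → 𝔘 u → All (Members P) (toList u)) → Members P (μ _≈_ 𝔘)
    μ-preserves good S (u , u∈𝔘 , ch , S≋) = P-resp S≋ (union-P (good u u∈𝔘) ch)
      where
      concat-P : ∀ {Ws} → All (λ W → P (toList W)) Ws → P (concatMap toList Ws)
      concat-P []         = P-[]
      concat-P (pW ∷ pWs) = P-++ pW (concat-P pWs)

      union-P : ∀ {ws : List (PQ Z q)} → All (Members P) ws → (ch : Choice ws) → P (unionOf ch)
      union-P []              []                = P-[]
      union-P (good𝒲 ∷ goods) ((𝒱 , 𝒱⊆𝒲) ∷ ch) =
        P-++ (concat-P (All.map (λ {W} → good𝒲 W) 𝒱⊆𝒲)) (union-P goods ch)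

Total : {B : Set} → List B → Set
Total ys = ∀ y → y ∈⟨ _≡_ ⟩ ys

module _ {A B : Set} where

  _≡×≡_ : Rel (A × B) 0ℓ
  _≡×≡_ = _≡_ ×ᴿ _≡_

  ≡×≡-trans : Transitive _≡×≡_
  ≡×≡-trans (refl , refl) (refl , refl) = refl , refl

  Saturated : List (A × B) → Set
  Saturated ps = ∀ {x y y′} → (x , y) ∈⟨ _≡×≡_ ⟩ ps → (x , y′) ∈⟨ _≡×≡_ ⟩ ps

  saturated-[] : Saturated []
  saturated-[] ()

  saturated-++ : ∀ {ps qs} → Saturated ps → Saturated qs → Saturated (ps ++ qs)
  saturated-++ {ps} sat-ps sat-qs xy∈ with Any.++⁻ ps xy∈
  ... | inj₁ xy∈ps = Any.++⁺ˡ (sat-ps xy∈ps)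
  ... | inj₂ xy∈qs = Any.++⁺ʳ ps (sat-qs xy∈qs)

  saturated-resp-SameSet : ∀ {ps qs} → SameSet _≡×≡_ ps qs → Saturated qs → Saturated ps
  saturated-resp-SameSet (ps⊆qs , qs⊆ps) sat-qs xy∈ps =
    ∈-resp-⊆ ≡×≡-trans (sat-qs (∈-resp-⊆ ≡×≡-trans xy∈ps ps⊆qs)) qs⊆ps

  fibre-saturated : (x : A) (ys : List B) → Total ys → Saturated (map (x ,_) ys)
  fibre-saturated x ys total {y′ = y′} xy∈
    with _ , x≡ , _ ← Any.satisfied (Any.map⁻ xy∈) =
    Any.map⁺ (Any.map (x≡ ,_) (total y′))

  stl-saturated : (x : A) (𝒱 : PQ B q) → Members Total 𝒱 →
                  Members Saturated (stl _≡×≡_ (x , 𝒱))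
  stl-saturated x 𝒱 total Z (W , W∈𝒱 , Z≋xW) =
    saturated-resp-SameSet Z≋xW (fibre-saturated x (toList W) (total W W∈𝒱))

  μ-stl-str-saturated : (𝒰 : PQ A 0ℓ) (𝒱 : PQ B 0ℓ) → Members Total 𝒱 →
    Members Saturated (μ _≡×≡_ (PQmap _≐ₚ_ (stl _≡×≡_) (str (_≡_ ×ᴿ _≐ₚ_) (𝒰 , 𝒱))))
  μ-stl-str-saturated 𝒰 𝒱 total =
    μ-preserves Saturated saturated-[] saturated-++ saturated-resp-SameSet families-saturated
    where
    families-saturated : ∀ u → PQmap _≐ₚ_ (stl _≡×≡_) (str (_≡_ ×ᴿ _≐ₚ_) (𝒰 , 𝒱)) u →
                         All (Members Saturated) (toList u)
    families-saturated u (W , (W₀ , _ , W⊆W₀𝒱 , _) , u⊆stlW , _) =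
      All.map family-saturated u⊆stlW
      where
      second-≐ : ∀ {w} → w ∈⟨ _≡_ ×ᴿ _≐ₚ_ ⟩ map (λ x → (x , 𝒱)) (toList W₀) → proj₂ w ≐ₚ 𝒱
      second-≐ w∈ = proj₂ (proj₂ (Any.satisfied (Any.map⁻ w∈)))

      family-saturated : ∀ {𝒲} → 𝒲 ∈⟨ _≐ₚ_ ⟩ map (stl _≡×≡_) (toList W) → Members Saturated 𝒲
      family-saturated 𝒲∈
        with 𝒱′≐𝒱 , 𝒲≐stl ← All.lookupAny (All.map second-≐ W⊆W₀𝒱) (Any.map⁻ 𝒲∈) =
        Members-resp-≐ {P = Saturated} 𝒲≐stl
          (stl-saturated _ _ (Members-resp-≐ {P = Total} 𝒱′≐𝒱 total))

  diagonal-∈-μ-str-stl : (𝒰 : PQ A 0ℓ) (𝒱 : PQ B 0ℓ) {x x′ : A} {y y′ : B} →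
    𝒰 [ x ]⁺ → 𝒰 [ x′ ]⁺ → 𝒱 (y ∷⁺ y′ ∷ []) →
    μ _≡×≡_ (PQmap _≐ₚ_ (str _≡×≡_) (stl (_≐ₚ_ ×ᴿ _≡_) (𝒰 , 𝒱))) ((x , y) ∷⁺ (x′ , y′) ∷ [])
  diagonal-∈-μ-str-stl 𝒰 𝒱 {x} {x′} {y} {y′} x∈𝒰 x′∈𝒰 yy′∈𝒱 =
    str _≡×≡_ (𝒰 , y) ∷⁺ str _≡×≡_ (𝒰 , y′) ∷ [] ,
    ((𝒰 , y) ∷⁺ (𝒰 , y′) ∷ [] ,
      (y ∷⁺ y′ ∷ [] , yy′∈𝒱 , SameSet-refl (≐-refl , refl) _) ,
      SameSet-refl ≐-refl _) ,
    ([ [ (x , y) ]⁺ ]⁺ , singleton-∈-str x∈𝒰 ∷ []) ∷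
      ([ [ (x′ , y′) ]⁺ ]⁺ , singleton-∈-str x′∈𝒰 ∷ []) ∷ [] ,
    SameSet-refl (refl , refl) _
    where
    ≐-refl : ∀ {C : Set} {𝒲 : PQ C 0ℓ} → 𝒲 ≐ₚ 𝒲
    ≐-refl W = (λ w → w) , (λ w → w)

    singleton-∈-str : ∀ {x y} → 𝒰 [ x ]⁺ → str _≡×≡_ (𝒰 , y) [ (x , y) ]⁺
    singleton-∈-str x∈𝒰 = [ _ ]⁺ , x∈𝒰 , SameSet-refl (refl , refl) _

  diagonal-unsaturated : {x x′ : A} {y y′ : B} → x ≢ x′ → y ≢ y′ →
                         ¬ Saturated ((x , y) ∷ (x′ , y′) ∷ [])
  diagonal-unsaturated {y′ = y′} x≢x′ y≢y′ sat with sat {y′ = y′} (here (refl , refl))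
  ... | here (_ , y′≡y)         = y≢y′ (sym y′≡y)
  ... | there (here (x≡x′ , _)) = x≢x′ x≡x′
  ... | there (there ())

_≟X_ : DecidableEquality X
x₁ ≟X x₁ = yes refl
x₁ ≟X x₂ = no λ ()
x₂ ≟X x₁ = no λ ()
x₂ ≟X x₂ = yes refl

_≟Y_ : DecidableEquality Y
y₁ ≟Y y₁ = yes refl
y₁ ≟Y y₂ = no λ ()
y₂ ≟Y y₁ = no λ ()
y₂ ≟Y y₂ = yes refl

V-total : Members Total V
V-total W (here (_ , y₁y₂⊆W)) y = ∈-resp-⊆ trans (y∈y₁y₂ y) y₁y₂⊆W
  where
  y∈y₁y₂ : ∀ y → y ∈⟨ _≡_ ⟩ (y₁ ∷ y₂ ∷ [])
  y∈y₁y₂ y₁ = here refl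
  y∈y₁y₂ y₂ = there (here refl)

mainTheorem14 : IsClosed U × IsClosed V × ¬ (lhs ≐ rhs)
mainTheorem14 =
  fromList-closed trans _ (toWitness {a? = unionsListed? _≟X_ _} _) ,
  fromList-closed trans _ (toWitness {a? = unionsListed? _≟Y_ _} _) ,
  λ lhs≐rhs → diagonal-unsaturated (λ ()) (λ ())
    (μ-stl-str-saturated U V V-total _ (proj₁ (lhs≐rhs _) diagonal∈lhs))
  where
  diagonal∈lhs : lhs ((x₁ , y₁) ∷⁺ (x₂ , y₂) ∷ [])
  diagonal∈lhs = diagonal-∈-μ-str-stl U V
    (here (SameSet-refl refl _)) (there (here (SameSet-refl refl _))) (here (SameSet-refl refl _))
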